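{- Let \(n\) be a power of \(2\) and let \(L\) be a set of \(n\) distinct infinite binary strings. Then \(p_{\log n}(L)\ge g(\mathbf{c}(L))\).
   Context: \(\log\) is base 2. For a set \(L=\{\alpha_0,\dots,\alpha_{n-1}\}\) of \(n\) distinct infinite binary strings and an integer \(k\ge 0\), the set of minimal \(k\)-prefixes \(\varphi_k(L)=\{\beta_0,\dots,\beta_{n-1}\}\) is defined by: each \(\beta_i\) is a prefix of \(\alpha_i\); \(|\beta_i|\ge k\) for all \(i\); \(\varphi_k(L)\) is prefix-free (no \(\beta_i\) is a prefix of \(\beta_j\), \(i\neq j\)); and \(\sum_i|\beta_i|\) is minimal among all sets satisfying the previous conditions. The \(k\)-excess path length is \(p_k(L)=\sum_{\beta\in\varphi_k(L)}(|\beta|-k)\). The occupancy vector \(\mathbf{c}(L)=(C_0,\dots,C_{n-1})\) is given by: \(C_j\) is the number of strings in \(L\) whose first \(\log n\) bits form the binary representation of \(j\). For a vector \(\mathbf{b}=(B_0,\dots,B_{n-1})\) of nonnegative integers, \(g(\mathbf{b})=\sum_{j:\,B_j>0}B_j\log B_j\). -}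

module Defs where

open import Data.Nat using (ℕ; zero; suc; _+_; _*_; _∸_; _^_; _≤_; _<_; _≡ᵇ_)
open import Data.Bool using (Bool; true; false; if_then_else_)
open import Data.Fin using (Fin; toℕ)
open import Data.List using (List; map; allFin)
open import Data.Nat.ListAction using (sum; product)
open import Data.Product using (_×_)
open import Relation.Binary.PropositionalEquality using (_≡_; _≢_)
open import Relation.Nullary using (¬_)

BinStr : Set
BinStr = ℕ → Bool

ΣFin : (n : ℕ) → (Fin n → ℕ) → ℕ
ΣFin n f = sum (map f (allFin n))

ΠFin : (n : ℕ) → (Fin n → ℕ) → ℕ
ΠFin n f = product (map f (allFin n))

Distinct : {n : ℕ} → (Fin n → BinStr) → Set
Distinct {n} L = ∀ (i j : Fin n) → i ≢ j → ¬ (∀ m → L i m ≡ L j m)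

-- A prefix of an infinite string α is determined by its length; the prefix
-- of α of length a is a prefix of the prefix of γ of length b iff a ≤ b and
-- α and γ agree on the first a positions.
IsPrefixOf : BinStr → ℕ → BinStr → ℕ → Set
IsPrefixOf α a γ b = a ≤ b × (∀ m → m < a → α m ≡ γ m)

-- ℓ i = |β_i| where β_i is the prefix of α_i of length ℓ i.
-- Conditions: |β_i| ≥ k and prefix-freeness.
IsKPrefixSet : {n : ℕ} → (Fin n → BinStr) → ℕ → (Fin n → ℕ) → Set
IsKPrefixSet {n} L k ℓ =
  (∀ i → k ≤ ℓ i) ×
  (∀ (i j : Fin n) → i ≢ j → ¬ IsPrefixOf (L i) (ℓ i) (L j) (ℓ j))

IsMinimalKPrefixes : {n : ℕ} → (Fin n → BinStr) → ℕ → (Fin n → ℕ) → Set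
IsMinimalKPrefixes {n} L k ℓ =
  IsKPrefixSet L k ℓ ×
  (∀ ℓ' → IsKPrefixSet L k ℓ' → ΣFin n ℓ ≤ ΣFin n ℓ')

excess : (n : ℕ) → ℕ → (Fin n → ℕ) → ℕ
excess n k ℓ = ΣFin n (λ i → ℓ i ∸ k)

firstBits : BinStr → ℕ → ℕ
firstBits α zero = 0
firstBits α (suc t) = 2 * firstBits α t + (if α t then 1 else 0)

-- Occupancy vector c(L) for n = 2^t (log n = t).
occupancy : (t : ℕ) → (Fin (2 ^ t) → BinStr) → Fin (2 ^ t) → ℕ
occupancy t L j =
  ΣFin (2 ^ t) (λ i → if firstBits (L i) t ≡ᵇ toℕ j then 1 else 0)

-- 2^{g(b)} = Π_{j : B_j > 0} B_j^{B_j}  (0^0 = 1 takes care of B_j = 0).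
expG : (n : ℕ) → (Fin n → ℕ) → ℕ
expG n B = ΠFin n (λ j → B j ^ B j)

{-# OPTIONS --safe #-}

-- Group the strings by their first t bits.  The prefixes in a group of c strings are
-- prefix-free and have length ≥ t, so beyond position t they form a prefix code with c words,
-- whose total length is at least c log c, i.e. c ^ c ≤ 2 ^ (excess of the group).  This
-- Kraft-type bound is proved by splitting a group of at least two words on its next bit into
-- a and b words: every word is longer than the shared prefix, so the excess drops by a + b,
-- and (a + b) ^ (a + b) ≤ 2 ^ (a + b) * a ^ a * b ^ b, the weighted AM–GM inequality at the
-- weights a, b and points b, a.  Multiplying over all groups gives 2 ^ g(c(L)) ≤ 2 ^ p_t(L).
module Submission where

open import Data.Nat
  using (ℕ; zero; suc; _+_; _*_; _∸_; _^_; _≤_; _<_; _≡ᵇ_; NonZero; z<s; s<s)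
open import Data.Nat.Properties
open import Data.Nat.Induction using (<-wellFounded)
open import Data.Nat.ListAction using (sum; product)
open import Data.Nat.Tactic.RingSolver using (solve-∀)
open import Data.Bool using (Bool; true; false; if_then_else_)
import Data.Bool.Properties as Bool
open import Data.Fin using (Fin; zero; suc; toℕ)
open import Data.List using (List; []; _∷_; map; length; filter; allFin; tabulate)
open import Data.List.Properties using (map-tabulate)
open import Data.List.Relation.Unary.All using (All; []; _∷_)
import Data.List.Relation.Unary.All as All
open import Data.List.Relation.Unary.All.Properties using (all-filter; filter⁺)
open import Data.List.Relation.Unary.AllPairs using (AllPairs; _∷_)
import Data.List.Relation.Unary.AllPairs as AllPairs
import Data.List.Relation.Unary.AllPairs.Properties as AllPairs
open import Data.List.Relation.Unary.Unique.Propositional.Properties using (allFin⁺)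
open import Data.Product using (_×_; _,_; proj₁; proj₂)
open import Data.Sum using (inj₁; inj₂)
open import Function using (_∘_; id)
open import Induction.WellFounded using (Acc; acc)
open import Relation.Binary.PropositionalEquality
  using (_≡_; refl; sym; trans; cong; cong₂; subst)
open import Relation.Nullary using (¬_; does; contradiction)
open import Relation.Unary using (Decidable)
open import Relation.Unary.Properties using (∁?)
open import Algebra.Properties.CommutativeSemigroup +-commutativeSemigroup using (x∙yz≈y∙xz)
open import Algebra.Properties.CommutativeMonoid.Sum +-0-commutativeMonoid
  using (sum-syntax; sum-cong-≗; sum-replicate-zero; ∑-comm)

open import Defs

open ≤-Reasoning

^-distribʳ-* : ∀ m n o → (m * n) ^ o ≡ m ^ o * n ^ o
^-distribʳ-* m n zero    = refl
^-distribʳ-* m n (suc o) = begin-equality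
  m * n * (m * n) ^ o      ≡⟨ cong (m * n *_) (^-distribʳ-* m n o) ⟩
  m * n * (m ^ o * n ^ o)  ≡⟨ interchange m n (m ^ o) (n ^ o) ⟩
  m * m ^ o * (n * n ^ o)  ∎
  where
  interchange : ∀ a b c d → a * b * (c * d) ≡ a * c * (b * d)
  interchange = solve-∀

rearrangement : ∀ {x y p q} → x ≤ y → p ≤ q → p * y + q * x ≤ p * x + q * y
rearrangement {x} {p = p} x≤y p≤q with m≤n⇒∃[o]m+o≡n x≤y | m≤n⇒∃[o]m+o≡n p≤q
... | d , refl | e , refl = begin
  p * (x + d) + (p + e) * x          ≤⟨ m≤m+n _ (e * d) ⟩
  p * (x + d) + (p + e) * x + e * d  ≡⟨ expand p x d e ⟩
  p * x + (p + e) * (x + d)          ∎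
  where
  expand : ∀ p x d e → p * (x + d) + (p + e) * x + e * d ≡ p * x + (p + e) * (x + d)
  expand = solve-∀

^-rearrangement : ∀ k x y → x ^ k * y + y ^ k * x ≤ x ^ k * x + y ^ k * y
^-rearrangement k x y with ≤-total x y
... | inj₁ x≤y = rearrangement x≤y (^-monoˡ-≤ k x≤y)
... | inj₂ y≤x = begin
  x ^ k * y + y ^ k * x  ≡⟨ +-comm (x ^ k * y) (y ^ k * x) ⟩
  y ^ k * x + x ^ k * y  ≤⟨ rearrangement y≤x (^-monoˡ-≤ k y≤x) ⟩
  y ^ k * y + x ^ k * x  ≡⟨ +-comm (y ^ k * y) (x ^ k * x) ⟩
  x ^ k * x + y ^ k * y  ∎

bernoulli : ∀ m x y → suc m * x * y ^ m ≤ x ^ suc m + m * y ^ suc m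
bernoulli zero x y = ≤-reflexive (base x)
  where
  base : ∀ x → 1 * x * 1 ≡ x * 1 + 0
  base = solve-∀
bernoulli (suc m) x y = begin
  suc (suc m) * x * (y * q)                  ≡⟨ peel m x y q ⟩
  x * (y * q) + y * (suc m * x * q)          ≤⟨ +-monoʳ-≤ _ (*-monoʳ-≤ y (bernoulli m x y)) ⟩
  x * (y * q) + y * (p + m * (y * q))        ≡⟨ regroup m x y p q ⟩
  (p * y + y * q * x) + m * (y * (y * q))    ≤⟨ +-monoˡ-≤ _ (^-rearrangement (suc m) x y) ⟩
  (p * x + y * q * y) + m * (y * (y * q))    ≡⟨ collect m x y p q ⟩
  x * p + suc m * (y * (y * q))              ∎
  where
  p = x ^ suc m
  q = y ^ m
  peel : ∀ m x y q → suc (suc m) * x * (y * q) ≡ x * (y * q) + y * (suc m * x * q)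
  peel = solve-∀
  regroup : ∀ m x y p q → x * (y * q) + y * (p + m * (y * q)) ≡ (p * y + y * q * x) + m * (y * (y * q))
  regroup = solve-∀
  collect : ∀ m x y p q → (p * x + y * q * y) + m * (y * (y * q)) ≡ x * p + suc m * (y * (y * q))
  collect = solve-∀

-- (s / n) ^ n * y ≤ ((s + y) / (n + 1)) ^ (n + 1) with the denominators cleared: the AM–GM
-- inequality for n numbers of sum s, extended by one more number y.
amgm-step : ∀ n s y → suc n ^ suc n * s ^ n * y ≤ n ^ n * (s + y) ^ suc n
amgm-step zero s y = begin
  1 * 1 * 1 * y    ≡⟨ *-identityˡ y ⟩
  y                ≤⟨ m≤n+m y s ⟩
  s + y            ≡⟨ trans (*-identityˡ _) (*-identityʳ (s + y)) ⟨
  1 * ((s + y) * 1) ∎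
amgm-step n@(suc _) s y = *-cancelˡ-≤ n (begin
  n * (suc n ^ suc n * s ^ n * y)      ≡⟨ regroup n (suc n ^ n) (s ^ n) y ⟩
  n * suc n * y * (suc n ^ n * s ^ n)  ≡⟨ cong (n * suc n * y *_) (^-distribʳ-* (suc n) s n) ⟨
  n * suc n * y * t ^ n                ≤⟨ +-cancelʳ-≤ (n * t ^ suc n) _ _ (begin
      n * suc n * y * t ^ n + n * t ^ suc n  ≡⟨ split n s y (t ^ n) ⟩
      suc n * x * t ^ n                      ≤⟨ bernoulli n x t ⟩
      x ^ suc n + n * t ^ suc n              ∎) ⟩
  x ^ suc n                            ≡⟨ ^-distribʳ-* n (s + y) (suc n) ⟩
  n ^ suc n * (s + y) ^ suc n          ≡⟨ *-assoc n (n ^ n) ((s + y) ^ suc n) ⟩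
  n * (n ^ n * (s + y) ^ suc n)        ∎)
  where
  x = n * (s + y)
  t = suc n * s
  regroup : ∀ n a b y → n * (suc n * a * b * y) ≡ n * suc n * y * (a * b)
  regroup = solve-∀
  split : ∀ n s y z → n * suc n * y * z + n * (suc n * s * z) ≡ suc n * (n * (s + y)) * z
  split = solve-∀

n^n≢0 : ∀ n → NonZero (n ^ n)
n^n≢0 zero    = _
n^n≢0 (suc n) = m^n≢0 (suc n) (suc n)

weighted-amgm : ∀ a b x y → (a + b) ^ (a + b) * (x ^ a * y ^ b) ≤ (a * x + b * y) ^ (a + b)
weighted-amgm a zero x y
  rewrite +-identityʳ a | +-identityʳ (a * x) | *-identityʳ (x ^ a) =
  ≤-reflexive (sym (^-distribʳ-* a x a))
weighted-amgm a (suc b) x y rewrite +-suc a b = *-cancelˡ-≤ (n ^ n) {{n^n≢0 n}} (begin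
  n ^ n * (suc n ^ suc n * (x ^ a * (y * y ^ b)))  ≡⟨ regroup (suc n ^ suc n) (n ^ n) (x ^ a) y (y ^ b) ⟩
  suc n ^ suc n * (n ^ n * (x ^ a * y ^ b)) * y    ≤⟨ *-monoˡ-≤ y (*-monoʳ-≤ (suc n ^ suc n) (weighted-amgm a b x y)) ⟩
  suc n ^ suc n * s ^ n * y                         ≤⟨ amgm-step n s y ⟩
  n ^ n * (s + y) ^ suc n                           ≡⟨ cong (λ z → n ^ n * z ^ suc n) (shift a x b y) ⟩
  n ^ n * (a * x + (y + b * y)) ^ suc n             ∎)
  where
  n = a + b
  s = a * x + b * y
  regroup : ∀ c d u y v → d * (c * (u * (y * v))) ≡ c * (d * (u * v)) * y
  regroup = solve-∀
  shift : ∀ a x b y → a * x + b * y + y ≡ a * x + (y + b * y)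
  shift = solve-∀

entropy-bound : ∀ a b → (a + b) ^ (a + b) ≤ 2 ^ (a + b) * (a ^ a * b ^ b)
entropy-bound zero b rewrite *-identityˡ (b ^ b) = m≤n*m (b ^ b) (2 ^ b) {{m^n≢0 2 b}}
entropy-bound a zero rewrite +-identityʳ a | *-identityʳ (a ^ a) = m≤n*m (a ^ a) (2 ^ a) {{m^n≢0 2 a}}
entropy-bound a@(suc _) b@(suc _) = *-cancelʳ-≤ _ _ q {{q≢0}} (begin
  n ^ n * q                                    ≤⟨ weighted-amgm a b b a ⟩
  (a * b + b * a) ^ n                          ≡⟨ cong (_^ n) (double a b) ⟩
  (2 * (a * b)) ^ n                            ≡⟨ ^-distribʳ-* 2 (a * b) n ⟩
  2 ^ n * (a * b) ^ n                          ≡⟨ cong (2 ^ n *_) (^-distribʳ-* a b n) ⟩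
  2 ^ n * (a ^ n * b ^ n)                      ≡⟨ cong₂ (λ u v → 2 ^ n * (u * v))
                                                        (^-distribˡ-+-* a a b) (^-distribˡ-+-* b a b) ⟩
  2 ^ n * ((a ^ a * a ^ b) * (b ^ a * b ^ b))  ≡⟨ regroup (2 ^ n) (a ^ a) (a ^ b) (b ^ a) (b ^ b) ⟩
  2 ^ n * (a ^ a * b ^ b) * q                  ∎)
  where
  n = a + b
  q = b ^ a * a ^ b
  q≢0 : NonZero q
  q≢0 = m*n≢0 (b ^ a) (a ^ b) {{m^n≢0 b a}} {{m^n≢0 a b}}
  double : ∀ a b → a * b + b * a ≡ 2 * (a * b)
  double = solve-∀
  regroup : ∀ c aᵃ aᵇ bᵃ bᵇ → c * ((aᵃ * aᵇ) * (bᵃ * bᵇ)) ≡ c * (aᵃ * bᵇ) * (bᵃ * aᵇ)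
  regroup = solve-∀

entropy-split : ∀ {a b u v} → a ^ a ≤ 2 ^ u → b ^ b ≤ 2 ^ v →
                (a + b) ^ (a + b) ≤ 2 ^ ((a + b) + (u + v))
entropy-split {a} {b} {u} {v} aᵃ≤2ᵘ bᵇ≤2ᵛ = begin
  (a + b) ^ (a + b)              ≤⟨ entropy-bound a b ⟩
  2 ^ (a + b) * (a ^ a * b ^ b)  ≤⟨ *-monoʳ-≤ (2 ^ (a + b)) (*-mono-≤ aᵃ≤2ᵘ bᵇ≤2ᵛ) ⟩
  2 ^ (a + b) * (2 ^ u * 2 ^ v)  ≡⟨ cong (2 ^ (a + b) *_) (^-distribˡ-+-* 2 u v) ⟨
  2 ^ (a + b) * 2 ^ (u + v)      ≡⟨ ^-distribˡ-+-* 2 (a + b) (u + v) ⟨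
  2 ^ ((a + b) + (u + v))        ∎

-- With this, firstBits α (suc t) is by definition 2 * firstBits α t + bit (α t).
bit : Bool → ℕ
bit b = if b then 1 else 0

double+bit-injective : ∀ x y b c → 2 * x + bit b ≡ 2 * y + bit c → x ≡ y × b ≡ c
double+bit-injective x y false false eq = *-cancelˡ-≡ x y 2 (+-cancelʳ-≡ 0 (2 * x) (2 * y) eq) , refl
double+bit-injective x y true  true  eq = *-cancelˡ-≡ x y 2 (+-cancelʳ-≡ 1 (2 * x) (2 * y) eq) , refl
double+bit-injective x y false true  eq =
  contradiction (trans (sym (+-identityʳ (2 * x))) (trans eq (+-comm (2 * y) 1))) (even≢odd x y)
double+bit-injective x y true  false eq =
  contradiction (trans (sym (+-identityʳ (2 * y))) (trans (sym eq) (+-comm (2 * x) 1))) (even≢odd y x)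

firstBits-suc : ∀ α {d K b} → firstBits α d ≡ K → α d ≡ b → firstBits α (suc d) ≡ 2 * K + bit b
firstBits-suc α refl refl = refl

firstBits-injective : ∀ d α β → firstBits α d ≡ firstBits β d → ∀ m → m < d → α m ≡ β m
firstBits-injective (suc d) α β eq m m<1+d
  with double+bit-injective (firstBits α d) (firstBits β d) (α d) (β d) eq | m<1+n⇒m<n∨m≡n m<1+d
... | same , _ | inj₁ m<d  = firstBits-injective d α β same m m<d
... | _ , αd≡βd | inj₂ refl = αd≡βd

firstBits<2^ : ∀ α t → firstBits α t < 2 ^ t
firstBits<2^ α zero    = z<s
firstBits<2^ α (suc t) = begin-strict
  2 * x + bit (α t)  <⟨ +-monoʳ-< (2 * x) (bit<2 (α t)) ⟩
  2 * x + 2          ≡⟨ +-comm (2 * x) 2 ⟩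
  2 + 2 * x          ≡⟨ *-suc 2 x ⟨
  2 * suc x          ≤⟨ *-monoʳ-≤ 2 (firstBits<2^ α t) ⟩
  2 * 2 ^ t          ∎
  where
  x = firstBits α t
  bit<2 : ∀ b → bit b < 2
  bit<2 false = z<s
  bit<2 true  = s<s z<s

module _ {A : Set} {P : A → Set} (P? : Decidable P) where

  length-filter-∁ : ∀ xs → length (filter P? xs) + length (filter (∁? P?) xs) ≡ length xs
  length-filter-∁ []       = refl
  length-filter-∁ (x ∷ xs) with does (P? x)
  ... | true  = cong suc (length-filter-∁ xs)
  ... | false = trans (+-suc _ _) (cong suc (length-filter-∁ xs))

  sum-map-filter-∁ : ∀ (f : A → ℕ) xs →
    sum (map f (filter P? xs)) + sum (map f (filter (∁? P?) xs)) ≡ sum (map f xs)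
  sum-map-filter-∁ f []       = refl
  sum-map-filter-∁ f (x ∷ xs) with does (P? x)
  ... | true  = trans (+-assoc (f x) _ _) (cong (f x +_) (sum-map-filter-∁ f xs))
  ... | false = trans (x∙yz≈y∙xz (sum (map f (filter P? xs))) (f x)
                                  (sum (map f (filter (∁? P?) xs))))
                      (cong (f x +_) (sum-map-filter-∁ f xs))

  sum-map-if : ∀ (f : A → ℕ) xs →
    sum (map (λ x → if does (P? x) then f x else 0) xs) ≡ sum (map f (filter P? xs))
  sum-map-if f []       = refl
  sum-map-if f (x ∷ xs) with does (P? x)
  ... | true  = cong (f x +_) (sum-map-if f xs)
  ... | false = sum-map-if f xs

  count-if : ∀ xs → sum (map (λ x → if does (P? x) then 1 else 0) xs) ≡ length (filter P? xs)
  count-if []       = refl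
  count-if (x ∷ xs) with does (P? x)
  ... | true  = cong suc (count-if xs)
  ... | false = count-if xs

module PrefixCode {A : Set} (str : A → BinStr) (len : A → ℕ) where

  _⊑_ : A → A → Set
  x ⊑ y = IsPrefixOf (str x) (len x) (str y) (len y)

  _∥_ : A → A → Set
  x ∥ y = ¬ x ⊑ y × ¬ y ⊑ x

  excessAbove : ℕ → List A → ℕ
  excessAbove d xs = sum (map (λ x → len x ∸ d) xs)

  excessAbove-suc : ∀ {d xs} → All (λ x → d < len x) xs →
                    excessAbove d xs ≡ length xs + excessAbove (suc d) xs
  excessAbove-suc []                         = refl
  excessAbove-suc {d} {x ∷ xs} (d<x ∷ d<xs) = begin-equality
    len x ∸ d + excessAbove d xs
      ≡⟨ cong₂ _+_ (+-∸-assoc 1 d<x) (excessAbove-suc d<xs) ⟩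
    suc (len x ∸ suc d) + (length xs + excessAbove (suc d) xs)
      ≡⟨ cong suc (x∙yz≈y∙xz (len x ∸ suc d) (length xs) (excessAbove (suc d) xs)) ⟩
    suc (length xs + (len x ∸ suc d + excessAbove (suc d) xs))
      ∎

  shared-prefix-< : ∀ {d x y} → firstBits (str x) d ≡ firstBits (str y) d →
                    d ≤ len x → d ≤ len y → ¬ x ⊑ y → d < len x
  shared-prefix-< {d} {x} {y} same d≤x d≤y x⋢y with m≤n⇒m<n∨m≡n d≤x
  ... | inj₁ d<x = d<x
  ... | inj₂ d≡x = contradiction x⊑y x⋢y
    where
    x⊑y : x ⊑ y
    x⊑y = subst (_≤ len y) d≡x d≤y
        , λ m m<x → firstBits-injective d (str x) (str y) same m (subst (m <_) (sym d≡x) m<x)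

  beyond-shared-prefix : ∀ {d K x y ys} →
    All (λ z → d ≤ len z) (x ∷ y ∷ ys) → All (λ z → firstBits (str z) d ≡ K) (x ∷ y ∷ ys) →
    AllPairs _∥_ (x ∷ y ∷ ys) → All (λ z → d < len z) (x ∷ y ∷ ys)
  beyond-shared-prefix (d≤x ∷ d≤ys) (x≡K ∷ ys≡K) (x∥ys ∷ _) =
    shared-prefix-< (trans x≡K (sym (All.head ys≡K))) d≤x (All.head d≤ys) (proj₁ (All.head x∥ys))
    ∷ All.tabulate (λ z∈ys → shared-prefix-< (trans (All.lookup ys≡K z∈ys) (sym x≡K))
                               (All.lookup d≤ys z∈ys) d≤x (proj₂ (All.lookup x∥ys z∈ys)))

  prefix-code-bound-acc : ∀ {d K} xs → Acc _<_ (excessAbove d xs) →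
    All (λ x → d ≤ len x) xs → All (λ x → firstBits (str x) d ≡ K) xs → AllPairs _∥_ xs →
    length xs ^ length xs ≤ 2 ^ excessAbove d xs
  prefix-code-bound-acc []       _ _ _ _ = ≤-refl
  prefix-code-bound-acc {d} (x ∷ []) _ _ _ _ = m^n>0 2 (len x ∸ d + 0)
  prefix-code-bound-acc {d} xs@(_ ∷ _ ∷ _) (acc smaller) d≤xs xs≡K xs∥ = begin
    length xs ^ length xs      ≡⟨ cong (λ n → n ^ n) (length-filter-∁ P? xs) ⟨
    (a + b) ^ (a + b)          ≤⟨ entropy-split {a} {b} {u} {v} (branch true P? id (m≤m+n u v))
                                                (branch false (∁? P?) Bool.¬-not (m≤n+m v u)) ⟩
    2 ^ ((a + b) + (u + v))    ≡⟨ cong (λ n → 2 ^ (n + (u + v))) (length-filter-∁ P? xs) ⟩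
    2 ^ (length xs + (u + v))  ≡⟨ cong (2 ^_) split ⟨
    2 ^ excessAbove d xs       ∎
    where
    P? : Decidable (λ z → str z d ≡ true)
    P? z = str z d Bool.≟ true
    a = length (filter P? xs)
    b = length (filter (∁? P?) xs)
    u = excessAbove (suc d) (filter P? xs)
    v = excessAbove (suc d) (filter (∁? P?) xs)
    d<xs = beyond-shared-prefix d≤xs xs≡K xs∥
    split : excessAbove d xs ≡ length xs + (u + v)
    split = trans (excessAbove-suc d<xs) (cong (length xs +_) (sym (sum-map-filter-∁ P? _ xs)))
    branch : ∀ bit-d {Q : A → Set} (Q? : Decidable Q) → (∀ {z} → Q z → str z d ≡ bit-d) →
             excessAbove (suc d) (filter Q? xs) ≤ u + v →
             length (filter Q? xs) ^ length (filter Q? xs) ≤ 2 ^ excessAbove (suc d) (filter Q? xs)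
    branch bit-d Q? Q⇒bit-d ≤u+v = prefix-code-bound-acc (filter Q? xs)
      (smaller (subst (excessAbove (suc d) (filter Q? xs) <_) (sym split)
                      (≤-<-trans ≤u+v (m<n+m (u + v) {length xs} z<s))))
      (filter⁺ Q? d<xs)
      (All.zipWith (λ {z} (q , z≡K) → firstBits-suc (str z) z≡K (Q⇒bit-d q))
                   (all-filter Q? xs , filter⁺ Q? xs≡K))
      (AllPairs.filter⁺ Q? xs∥)

  prefix-code-bound : ∀ {d K} xs →
    All (λ x → d ≤ len x) xs → All (λ x → firstBits (str x) d ≡ K) xs → AllPairs _∥_ xs →
    length xs ^ length xs ≤ 2 ^ excessAbove d xs
  prefix-code-bound {d} xs = prefix-code-bound-acc xs (<-wellFounded (excessAbove d xs))

  bucket-bound : ∀ {d} K xs → All (λ x → d ≤ len x) xs → AllPairs _∥_ xs →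
    let c = sum (map (λ x → if firstBits (str x) d ≡ᵇ K then 1 else 0) xs) in
    c ^ c ≤ 2 ^ sum (map (λ x → if firstBits (str x) d ≡ᵇ K then len x ∸ d else 0) xs)
  bucket-bound {d} K xs d≤xs xs∥ = begin
    _ ≡⟨ cong (λ c → c ^ c) (count-if in-bucket? xs) ⟩
    length B ^ length B  ≤⟨ prefix-code-bound B (filter⁺ in-bucket? d≤xs) (all-filter in-bucket? xs)
                                                 (AllPairs.filter⁺ in-bucket? xs∥) ⟩
    2 ^ excessAbove d B  ≡⟨ cong (2 ^_) (sum-map-if in-bucket? (λ x → len x ∸ d) xs) ⟨
    _ ∎
    where
    in-bucket? : Decidable (λ x → firstBits (str x) d ≡ K)
    in-bucket? x = firstBits (str x) d ≟ K
    B = filter in-bucket? xs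

product-map-mono : ∀ {A : Set} {f g : A → ℕ} → (∀ x → f x ≤ g x) →
                   ∀ xs → product (map f xs) ≤ product (map g xs)
product-map-mono f≤g []       = ≤-refl
product-map-mono f≤g (x ∷ xs) = *-mono-≤ (f≤g x) (product-map-mono f≤g xs)

product-map-^ : ∀ {A : Set} m (f : A → ℕ) xs → product (map (λ x → m ^ f x) xs) ≡ m ^ sum (map f xs)
product-map-^ m f []       = refl
product-map-^ m f (x ∷ xs) =
  trans (cong (m ^ f x *_) (product-map-^ m f xs)) (sym (^-distribˡ-+-* m (f x) (sum (map f xs))))

ΣFin≡∑ : ∀ n (f : Fin n → ℕ) → ΣFin n f ≡ ∑[ i < n ] f i
ΣFin≡∑ zero    f = refl
ΣFin≡∑ (suc n) f = cong (f zero +_) (begin-equality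
  sum (map f (tabulate suc))  ≡⟨ cong sum (map-tabulate suc f) ⟩
  sum (tabulate (f ∘ suc))    ≡⟨ cong sum (map-tabulate id (f ∘ suc)) ⟨
  ΣFin n (f ∘ suc)            ≡⟨ ΣFin≡∑ n (f ∘ suc) ⟩
  ∑[ i < n ] f (suc i)        ∎)

∑-indicator : ∀ {n k} w → k < n → ∑[ j < n ] (if k ≡ᵇ toℕ j then w else 0) ≡ w
∑-indicator {suc n} {zero}  w _         = trans (cong (w +_) (sum-replicate-zero n)) (+-identityʳ w)
∑-indicator {suc n} {suc k} w (s<s k<n) = ∑-indicator w k<n

ΣFin-buckets : ∀ m n (key : Fin m → ℕ) (w : Fin m → ℕ) → (∀ i → key i < n) →
  ΣFin n (λ j → ΣFin m (λ i → if key i ≡ᵇ toℕ j then w i else 0)) ≡ ΣFin m w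
ΣFin-buckets m n key w key<n = begin-equality
  ΣFin n (λ j → ΣFin m (λ i → f i j))  ≡⟨ ΣFin≡∑ n (λ j → ΣFin m (λ i → f i j)) ⟩
  ∑[ j < n ] ΣFin m (λ i → f i j)      ≡⟨ sum-cong-≗ (λ j → ΣFin≡∑ m (λ i → f i j)) ⟩
  ∑[ j < n ] ∑[ i < m ] f i j          ≡⟨ ∑-comm (λ j i → f i j) ⟩
  ∑[ i < m ] ∑[ j < n ] f i j          ≡⟨ sum-cong-≗ (λ i → ∑-indicator (w i) (key<n i)) ⟩
  ∑[ i < m ] w i                        ≡⟨ ΣFin≡∑ m w ⟨
  ΣFin m w                              ∎
  where
  f : Fin m → Fin n → ℕ
  f i j = if key i ≡ᵇ toℕ j then w i else 0

corollary1 : (t : ℕ) (L : Fin (2 ^ t) → BinStr) → Distinct L →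
    (ℓ : Fin (2 ^ t) → ℕ) → IsMinimalKPrefixes L t ℓ →
    expG (2 ^ t) (occupancy t L) ≤ 2 ^ excess (2 ^ t) t ℓ
corollary1 t L _ ℓ ((t≤ℓ , prefix-free) , _) = begin
  expG N (occupancy t L)
    ≤⟨ product-map-mono (λ j → bucket-bound (toℕ j) I t≤I I∥) I ⟩
  ΠFin N (λ j → 2 ^ ΣFin N (excess-in j))
    ≡⟨ product-map-^ 2 (λ j → ΣFin N (excess-in j)) I ⟩
  2 ^ ΣFin N (λ j → ΣFin N (excess-in j))
    ≡⟨ cong (2 ^_) (ΣFin-buckets N N key (λ i → ℓ i ∸ t) key<N) ⟩
  2 ^ excess N t ℓ
    ∎
  where
  N = 2 ^ t
  I = allFin N
  open PrefixCode L ℓ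
  key : Fin N → ℕ
  key i = firstBits (L i) t
  key<N : ∀ i → key i < N
  key<N i = firstBits<2^ (L i) t
  excess-in : Fin N → Fin N → ℕ
  excess-in j i = if key i ≡ᵇ toℕ j then ℓ i ∸ t else 0
  t≤I : All (λ i → t ≤ ℓ i) I
  t≤I = All.universal t≤ℓ I
  I∥ : AllPairs _∥_ I
  I∥ = AllPairs.map (λ i≢j → prefix-free _ _ i≢j , prefix-free _ _ (i≢j ∘ sym)) (allFin⁺ N)
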